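{- Let $A=(Ctrl,Sto,\mathit{init},\mathit{fin},\to)$ and $A'=(Ctrl',Sto',\mathit{init}',\mathit{fin}',\to')$ be automata, let $L,R,J$ be live alignment conditions for $A,A'$, and let $\mathcal{Q}\subseteq Sto\times Sto'$. If the alignment automaton $\prod(A,A',L,R,J)$ is manifestly $\mathcal{Q}$-adequate, then it is $\mathcal{Q}$-adequate.
   Context: An automaton is a tuple $(Ctrl,Sto,\mathit{init},\mathit{fin},\to)$ where $Sto$ is a set (data stores), $Ctrl$ is a finite set (control points) containing distinct elements $\mathit{init},\mathit{fin}$, and $\to\ \subseteq (Ctrl\times Sto)\times(Ctrl\times Sto)$ is such that $(n,s)\to(m,t)$ implies $n\neq\mathit{fin}$ and $n\neq m$. A state is an element of $Ctrl\times Sto$. Given automata $A,A'$ as in the claim, sets $L,R,J\subseteq (Ctrl\times Ctrl')\times(Sto\times Sto')$ are live if every $((n,n'),(s,s'))\in L$ has $(n,s)\in\mathrm{dom}(\to)$, every $((n,n'),(s,s'))\in R$ has $(n',s')\in\mathrm{dom}(\to')$, and every $((n,n'),(s,s'))\in J$ has both. The alignment automaton $\prod(A,A',L,R,J)$ is the automaton $(Ctrl\times Ctrl', Sto\times Sto', (\mathit{init},\mathit{init}'),(\mathit{fin},\mathit{fin}'),\Rightarrow)$ where $((n,n'),(s,s'))\Rightarrow((m,m'),(t,t'))$ iff one of: (LO) $((n,n'),(s,s'))\in L$, $(n,s)\to(m,t)$ and $(n',s')=(m',t')$; (RO) $((n,n'),(s,s'))\in R$, $(n,s)=(m,t)$ and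 $(n',s')\to'(m',t')$; (JO) $((n,n'),(s,s'))\in J$, $(n,s)\to(m,t)$ and $(n',s')\to'(m',t')$. Write $[\mathit{fin}|\mathit{fin}']$ for the set of product states whose control is $(\mathit{fin},\mathit{fin}')$. The product is $\mathcal{Q}$-adequate if for all $(s,s')\in\mathcal{Q}$ and all $t,t'$ with $(\mathit{init},s)\to^*(\mathit{fin},t)$ and $(\mathit{init}',s')\to'^*(\mathit{fin}',t')$ we have $((\mathit{init},\mathit{init}'),(s,s'))\Rightarrow^*((\mathit{fin},\mathit{fin}'),(t,t'))$. It is manifestly $\mathcal{Q}$-adequate if $L\cup R\cup J\cup[\mathit{fin}|\mathit{fin}']$ contains every product state reachable (via $\Rightarrow^*$) from some $((\mathit{init},\mathit{init}'),(s,s'))$ with $(s,s')\in\mathcal{Q}$. -}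

module Defs where

open import Data.Product using (Σ; ∃; _×_; _,_; proj₁; proj₂)
open import Data.Sum using (_⊎_)
open import Data.List using (List)
open import Data.List.Membership.Propositional using (_∈_)
open import Relation.Nullary using (¬_)
open import Relation.Binary.PropositionalEquality using (_≡_)
open import Relation.Binary.Construct.Closure.ReflexiveTransitive using (Star)

Pred : Set → Set₁
Pred X = X → Set

dom : {X : Set} → (X → X → Set) → Pred X
dom {X} r x = ∃ λ (y : X) → r x y

IsFinite : Set → Set
IsFinite C = ∃ λ (xs : List C) → ∀ c → c ∈ xs

record Automaton : Set₁ where
  field
    Ctrl      : Set
    Sto       : Set
    ctrlFinite : IsFinite Ctrl
    init      : Ctrl
    fin       : Ctrl
    init≢fin  : ¬ (init ≡ fin)
    _⟶_       : (Ctrl × Sto) → (Ctrl × Sto) → Set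
    fin-final : ∀ {n s m t} → (n , s) ⟶ (m , t) → ¬ (n ≡ fin)
    ctrl-moves : ∀ {n s m t} → (n , s) ⟶ (m , t) → ¬ (n ≡ m)

  State : Set
  State = Ctrl × Sto

  _⟶*_ : State → State → Set
  _⟶*_ = Star _⟶_

open Automaton

module _ (A A' : Automaton) where

  PState : Set
  PState = (Ctrl A × Ctrl A') × (Sto A × Sto A')

  left : PState → State A
  left ((n , n') , (s , s')) = (n , s)

  right : PState → State A'
  right ((n , n') , (s , s')) = (n' , s')

  Live : (L R J : Pred PState) → Set
  Live L R J =
      (∀ p → L p → dom (_⟶_ A) (left p))
    × (∀ p → R p → dom (_⟶_ A') (right p))
    × (∀ p → J p → dom (_⟶_ A) (left p) × dom (_⟶_ A') (right p))

  data AlignStep (L R J : Pred PState) : PState → PState → Set where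
    LO : ∀ {p q} → L p → _⟶_ A (left p) (left q) → right p ≡ right q →
         AlignStep L R J p q
    RO : ∀ {p q} → R p → left p ≡ left q → _⟶_ A' (right p) (right q) →
         AlignStep L R J p q
    JO : ∀ {p q} → J p → _⟶_ A (left p) (left q) → _⟶_ A' (right p) (right q) →
         AlignStep L R J p q

  alignment : (L R J : Pred PState) → Automaton
  alignment L R J = record
    { Ctrl = Ctrl A × Ctrl A'
    ; Sto = Sto A × Sto A'
    ; ctrlFinite = finProd (ctrlFinite A) (ctrlFinite A')
    ; init = (init A , init A')
    ; fin = (fin A , fin A')
    ; init≢fin = λ eq → init≢fin A (cong proj₁ eq)
    ; _⟶_ = AlignStep L R J
    ; fin-final = finFinal
    ; ctrl-moves = ctrlMoves
    }
    where
    open import Relation.Binary.PropositionalEquality using (cong; refl)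
    open import Data.List using (cartesianProduct)
    open import Data.List.Membership.Propositional.Properties using (∈-cartesianProduct⁺)
    finProd : ∀ {X Y} → IsFinite X → IsFinite Y → IsFinite (X × Y)
    finProd (xs , px) (ys , py) =
      cartesianProduct xs ys , λ { (x , y) → ∈-cartesianProduct⁺ (px x) (py y) }
    finFinal : ∀ {n s m t} → AlignStep L R J (n , s) (m , t) → ¬ (n ≡ (fin A , fin A'))
    finFinal (LO _ st _) eq = fin-final A st (cong proj₁ eq)
    finFinal (RO _ _ st) eq = fin-final A' st (cong proj₂ eq)
    finFinal (JO _ st _) eq = fin-final A st (cong proj₁ eq)
    ctrlMoves : ∀ {n s m t} → AlignStep L R J (n , s) (m , t) → ¬ (n ≡ m)
    ctrlMoves (LO _ st _) eq = ctrl-moves A st (cong proj₁ eq)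
    ctrlMoves (RO _ _ st) eq = ctrl-moves A' st (cong proj₂ eq)
    ctrlMoves (JO _ st _) eq = ctrl-moves A st (cong proj₁ eq)

  FinFin : Pred PState
  FinFin ((n , n') , _) = (n ≡ fin A) × (n' ≡ fin A')

  module _ (L R J : Pred PState) where

    _⇒*_ : PState → PState → Set
    _⇒*_ = Star (AlignStep L R J)

    Adequate : Pred (Sto A × Sto A') → Set
    Adequate Q = ∀ s s' t t' → Q (s , s') →
      _⟶*_ A (init A , s) (fin A , t) →
      _⟶*_ A' (init A' , s') (fin A' , t') →
      ((init A , init A') , (s , s')) ⇒* ((fin A , fin A') , (t , t'))

    ManifestlyAdequate : Pred (Sto A × Sto A') → Set
    ManifestlyAdequate Q = ∀ s s' p → Q (s , s') →
      ((init A , init A') , (s , s')) ⇒* p →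
      L p ⊎ R p ⊎ J p ⊎ FinFin p

{-# OPTIONS --safe #-}
module Submission where

open import Data.Product using (_×_; _,_; ∃; proj₁; proj₂)
open import Data.Sum using (_⊎_; inj₁; inj₂)
open import Data.Empty using (⊥-elim)
open import Relation.Nullary using (¬_)
open import Relation.Binary.PropositionalEquality using (refl)
open import Relation.Binary.Construct.Closure.ReflexiveTransitive using (ε; _◅_; _◅◅_)
open import Defs
open Automaton

-- Follow the two given runs, letting the condition (L, R or J) that holds at the
-- current product state decide which side moves; manifest adequacy says one of them
-- holds at every state reachable from Q, unless we are in [fin|fin']. Liveness
-- guarantees the scheduled side has not yet finished its run, since fin has no
-- successors; and in [fin|fin'] both runs are necessarily exhausted.

fin-halted : (A : Automaton) → ∀ {s} → ¬ dom (_⟶_ A) (fin A , s)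
fin-halted A (_ , step) = fin-final A step refl

Scheduled : (A A' : Automaton) (L R J : Pred (PState A A')) → Pred (PState A A')
Scheduled A A' L R J p = L p ⊎ R p ⊎ J p ⊎ FinFin A A' p

module _ {A A' : Automaton} {L R J : Pred (PState A A')} (live : Live A A' L R J) where

  private
    _⇒_ _⇒⋆_ : PState A A' → PState A A' → Set
    _⇒_ = AlignStep A A' L R J
    _⇒⋆_ = _⇒*_ A A' L R J

    live-L : ∀ p → L p → dom (_⟶_ A) (left A A' p)
    live-L = live .proj₁

    live-R : ∀ p → R p → dom (_⟶_ A') (right A A' p)
    live-R = live .proj₂ .proj₁

    live-J : ∀ p → J p → dom (_⟶_ A) (left A A' p) × dom (_⟶_ A') (right A A' p)
    live-J = live .proj₂ .proj₂

  align-runs :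
    (I : Pred (PState A A')) →
    (∀ {p q} → I p → p ⇒ q → I q) →
    (∀ {p} → I p → Scheduled A A' L R J p) →
    ∀ {n n' u u' t t'} → I ((n , n') , (u , u')) →
    _⟶*_ A (n , u) (fin A , t) →
    _⟶*_ A' (n' , u') (fin A' , t') →
    ((n , n') , (u , u')) ⇒⋆ ((fin A , fin A') , (t , t'))
  align-runs I closed scheduled i run run' with scheduled i
  ... | inj₁ l with run
  ...   | ε = ⊥-elim (fin-halted A (live-L _ l))
  ...   | step ◅ steps =
          LO l step refl ◅ align-runs I closed scheduled (closed i (LO l step refl)) steps run'
  align-runs I closed scheduled i run run' | inj₂ (inj₁ r) with run'
  ...   | ε = ⊥-elim (fin-halted A' (live-R _ r))
  ...   | step' ◅ steps' =
          RO r refl step' ◅ align-runs I closed scheduled (closed i (RO r refl step')) run steps'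
  align-runs I closed scheduled i run run' | inj₂ (inj₂ (inj₁ j)) with run | run'
  ...   | ε | _ = ⊥-elim (fin-halted A (live-J _ j .proj₁))
  ...   | _ ◅ _ | ε = ⊥-elim (fin-halted A' (live-J _ j .proj₂))
  ...   | step ◅ steps | step' ◅ steps' =
          JO j step step' ◅ align-runs I closed scheduled (closed i (JO j step step')) steps steps'
  align-runs I closed scheduled i run run' | inj₂ (inj₂ (inj₂ (refl , refl))) with run | run'
  ...   | ε | ε = ε
  ...   | step ◅ _ | _ = ⊥-elim (fin-halted A (_ , step))
  ...   | ε | step' ◅ _ = ⊥-elim (fin-halted A' (_ , step'))

lemma4p5 : (A A' : Automaton) (L R J : Pred (PState A A')) →
    Live A A' L R J → (Q : Pred (Automaton.Sto A × Automaton.Sto A')) →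
    ManifestlyAdequate A A' L R J Q → Adequate A A' L R J Q
lemma4p5 A A' L R J live Q manifest s s' t t' q run run' =
  align-runs live ReachableFromQ extend covered (s , s' , q , ε) run run'
  where
  ReachableFromQ : Pred (PState A A')
  ReachableFromQ p = ∃ λ s → ∃ λ s' → Q (s , s') × _⇒*_ A A' L R J ((init A , init A') , (s , s')) p

  extend : ∀ {p q} → ReachableFromQ p → AlignStep A A' L R J p q → ReachableFromQ q
  extend (s , s' , q , reach) step = s , s' , q , reach ◅◅ (step ◅ ε)

  covered : ∀ {p} → ReachableFromQ p → Scheduled A A' L R J p
  covered (s , s' , q , reach) = manifest s s' _ q reach
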